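{- Let $H$ be a graph on at most $n$ vertices and let $S=(v_i)_{i\in\mathbb N}$ be a sequence of vertices of $[n]$ chosen independently and uniformly at random with replacement. Then, in the offline semi-random process with offered sequence $S$, the smallest number of rounds after which Builder (knowing $S$ in advance) can have a multigraph containing a copy of $H$ equals $m(H)$.
   Context: Semi-random multigraph process, offline version: starting from the empty multigraph on $[n]$, in round $i$ Builder is offered $v_i$ and chooses a vertex $u_i\in[n]$, adding the edge $u_iv_i$; in the offline version Builder knows the entire sequence $S$ before the game starts. For a digraph $D$ with vertex set $\{w_1,\dots,w_r\}$ and out-degrees $d_1^+,\dots,d_r^+$, let $m(D)$ be the smallest integer $j$ such that among $(v_1,\dots,v_j)$ there are $r$ distinct vertices $x_1,\dots,x_r\in[n]$ such that $x_i$ appears at least $d_i^+$ times in $(v_1,\dots,v_j)$ for every $1\le i\le r$. For an undirected graph $H$, $m(H)=\min\{m(D): D\text{ is an orientation of } H\}$. -}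

module Defs where

open import Data.Nat using (ℕ; zero; suc; _+_; _≤_; _<_)
open import Data.Bool using (Bool; true; false; if_then_else_)
open import Data.Fin using (Fin; toℕ) renaming (zero to fzero; suc to fsuc)
open import Data.Fin.Properties using (_≟_)
open import Data.Product using (Σ; Σ-syntax; _×_)
open import Data.Sum using (_⊎_)
open import Relation.Nullary using (¬_; does)
open import Relation.Binary.PropositionalEquality using (_≡_)
open import Function.Definitions using (Injective)

countFin : ∀ {r} → (Fin r → Bool) → ℕ
countFin {zero}  f = 0
countFin {suc r} f = (if f fzero then 1 else 0) + countFin (λ b → f (fsuc b))

-- number of rounds i < j (0-indexed) in which vertex x is offered: |{i < j : S i = x}|
occ : ∀ {n} → (ℕ → Fin n) → ℕ → Fin n → ℕ
occ S zero    x = 0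
occ S (suc j) x = occ S j x + (if does (S j ≟ x) then 1 else 0)

record SimpleGraph (r : ℕ) : Set where
  field
    adj    : Fin r → Fin r → Bool
    sym    : ∀ a b → adj a b ≡ adj b a
    irrefl : ∀ a → adj a a ≡ false
open SimpleGraph public

record Orientation {r : ℕ} (H : SimpleGraph r) : Set where
  field
    arc      : Fin r → Fin r → Bool
    arc⇒edge : ∀ a b → arc a b ≡ true → adj H a b ≡ true
    edge⇒arc : ∀ a b → adj H a b ≡ true → (arc a b ≡ true) ⊎ (arc b a ≡ true)
    antisym  : ∀ a b → arc a b ≡ true → arc b a ≡ false
open Orientation public

outdeg : ∀ {r} {H : SimpleGraph r} → Orientation H → Fin r → ℕ
outdeg D a = countFin (arc D a)

IsLeast : (ℕ → Set) → ℕ → Set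
IsLeast P k = P k × (∀ j → j < k → ¬ P j)

CondD : ∀ {n r} {H : SimpleGraph r} → (ℕ → Fin n) → Orientation H → ℕ → Set
CondD {n} {r} S D j =
  Σ[ x ∈ (Fin r → Fin n) ] Injective _≡_ _≡_ x × (∀ a → outdeg D a ≤ occ S j (x a))

mD≡ : ∀ {n r} {H : SimpleGraph r} → (ℕ → Fin n) → Orientation H → ℕ → Set
mD≡ S D k = IsLeast (CondD S D) k

mH≡ : ∀ {n r} → SimpleGraph r → (ℕ → Fin n) → ℕ → Set
mH≡ H S k =
  Σ[ D ∈ Orientation H ] (mD≡ S D k × (∀ (D' : Orientation H) k' → mD≡ S D' k' → k ≤ k'))

-- Builder, knowing S, can choose u_1..u_j (u i for round i, paired with S i) so that the
-- multigraph with edges {u_i, S i} (i < j) contains a copy of H: an injective map f with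
-- every edge ab of H realised by some round's edge {f a, f b}.
-- (distinct edges of simple H map to distinct vertex pairs, hence distinct multigraph edges)
BuilderCan : ∀ {n r} → SimpleGraph r → (ℕ → Fin n) → ℕ → Set
BuilderCan {n} {r} H S j =
  Σ[ u ∈ (Fin j → Fin n) ] Σ[ f ∈ (Fin r → Fin n) ] Injective _≡_ _≡_ f ×
    (∀ a b → adj H a b ≡ true →
      Σ[ i ∈ Fin j ] ((u i ≡ f a × S (toℕ i) ≡ f b) ⊎ (u i ≡ f b × S (toℕ i) ≡ f a)))

module Submission where

-- The offline semi-random game: Builder can own a copy of H after j rounds
-- if and only if some orientation D of H satisfies the condition defining
-- m(D) at j, i.e. there are distinct host vertices x_a (a ∈ V(H)) such that
-- x_a is offered at least d⁺(a) times among the first j rounds.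
--
--  * (⇐) Fix D and x.  Builder answers the t-th offer of x_a (t < d⁺(a)) by
--    joining it to x_b, where b is the t-th out-neighbour of a in D; every arc
--    a → b of D is then realised.
--  * (⇒) Orient each edge ab of H from the endpoint that was offered in a round
--    realising it (ties broken by the order of Fin r).  Distinct out-neighbours
--    of a are realised in distinct rounds offering f(a), so d⁺(a) ≤ occ(f a).
--
-- Hence the predicates "Builder can win by round j" and "some orientation
-- satisfies the m(D)-condition at j" coincide, and a general fact about least
-- elements turns this into: the least such j equals min_D m(D) = m(H).

open import Defs hiding (sym)
open import Data.Nat using (ℕ; zero; suc; _+_; _≤_; _<_; z≤n; s≤s; s≤s⁻¹; _<?_)
open import Data.Nat.Properties
  using (≤-refl; ≤-trans; ≤-antisym; <-irrefl; <-≤-trans; <⇒≢; <-cmp; ≮⇒≥;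
         m≤m+n; m≤n⇒m<n∨m≡n; m<n⇒m<1+n; +-comm; +-identityʳ; +-monoʳ-<; +-cancelˡ-≡)
open import Data.Nat.Induction using (<-rec)
open import Data.Bool using (Bool; true; false; if_then_else_)
open import Data.Fin using (Fin; toℕ; fromℕ<) renaming (zero to fzero; suc to fsuc)
open import Data.Fin.Properties
  using (any?; toℕ-fromℕ<; toℕ-injective; toℕ<n; injective⇒≤) renaming (_≟_ to _≟ᶠ_)
import Data.Fin.Properties as Fin
import Data.Bool.Properties as Bool
open import Data.Product using (Σ-syntax; _×_; _,_; proj₁; proj₂)
open import Data.Sum using (_⊎_; inj₁; inj₂; [_,_])
open import Data.Empty using (⊥-elim)
open import Function using (_∘_)
open import Function.Bundles using (_⇔_; mk⇔; Equivalence)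
open import Function.Definitions using (Injective)
open import Relation.Binary.Definitions using (tri<; tri≈; tri>)
open import Relation.Nullary using (¬_; Dec; does; yes; no; contradiction)
open import Relation.Nullary.Decidable using (dec-true; dec-false; _×-dec_)
open import Relation.Binary.PropositionalEquality
  using (_≡_; refl; sym; trans; cong; subst; module ≡-Reasoning)

-- rank f b: the number of c < b with f c = true, i.e. the position of b in the
-- increasing enumeration of the true set of f.
rank : ∀ {r} → (Fin r → Bool) → Fin r → ℕ
rank f fzero    = 0
rank f (fsuc b) = (if f fzero then 1 else 0) + rank (f ∘ fsuc) b

rank-fsuc : ∀ {r} (f : Fin (suc r) → Bool) {x} → f fzero ≡ x → ∀ b →
            rank f (fsuc b) ≡ (if x then 1 else 0) + rank (f ∘ fsuc) b
rank-fsuc f refl b = refl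

rank<countFin : ∀ {r} (f : Fin r → Bool) b → f b ≡ true → rank f b < countFin f
rank<countFin f fzero    fb rewrite fb = s≤s z≤n
rank<countFin f (fsuc b) fb =
  +-monoʳ-< (if f fzero then 1 else 0) (rank<countFin (f ∘ fsuc) b fb)

rank-injective : ∀ {r} (f : Fin r → Bool) {b c} → f b ≡ true → f c ≡ true →
                 rank f b ≡ rank f c → b ≡ c
rank-injective f {fzero}  {fzero}  _  _  _ = refl
rank-injective f {fzero}  {fsuc c} fb _  q rewrite fb = contradiction q λ ()
rank-injective f {fsuc b} {fzero}  _  fc q rewrite fc = contradiction q λ ()
rank-injective f {fsuc b} {fsuc c} fb fc q =
  cong fsuc (rank-injective (f ∘ fsuc) fb fc (+-cancelˡ-≡ (if f fzero then 1 else 0) _ _ q))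

select : ∀ {r} (f : Fin r → Bool) t → t < countFin f →
         Σ[ b ∈ Fin r ] (f b ≡ true × rank f b ≡ t)
select {zero}  f t       ()
select {suc r} f t       t<c with f fzero in f0
select {suc r} f zero    t<c | true = fzero , f0 , refl
select {suc r} f (suc t) t<c | true with select (f ∘ fsuc) t (s≤s⁻¹ t<c)
... | b , fb , rb = fsuc b , fb , trans (rank-fsuc f f0 b) (cong suc rb)
select {suc r} f t       t<c | false with select (f ∘ fsuc) t t<c
... | b , fb , rb = fsuc b , fb , trans (rank-fsuc f f0 b) rb

countFin-≤ : ∀ {r m} (g : Fin r → Bool) (φ : ∀ b → g b ≡ true → Fin m) →
             (∀ {b c} gb gc → φ b gb ≡ φ c gc → b ≡ c) → countFin g ≤ m
countFin-≤ {r} g φ φ-injective = injective⇒≤ {f = index} index-injective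
  where
  selectFin : (t : Fin (countFin g)) → Σ[ b ∈ Fin r ] (g b ≡ true × rank g b ≡ toℕ t)
  selectFin t = select g (toℕ t) (toℕ<n t)

  index : Fin (countFin g) → Fin _
  index t = let (b , gb , _) = selectFin t in φ b gb

  index-injective : Injective _≡_ _≡_ index
  index-injective {t} {t'} eq = toℕ-injective (begin
    toℕ t                          ≡⟨ sym (proj₂ (proj₂ (selectFin t))) ⟩
    rank g (proj₁ (selectFin t))   ≡⟨ cong (rank g) (φ-injective _ _ eq) ⟩
    rank g (proj₁ (selectFin t'))  ≡⟨ proj₂ (proj₂ (selectFin t')) ⟩
    toℕ t'                         ∎)
    where open ≡-Reasoning

module Occurrences {n} (S : ℕ → Fin n) where

  occ-step : ∀ i y → S i ≡ y → occ S (suc i) y ≡ suc (occ S i y)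
  occ-step i y Si≡y with S i ≟ᶠ y
  ... | yes _   = +-comm (occ S i y) 1
  ... | no Si≢y = contradiction Si≡y Si≢y

  occ-mono : ∀ {i j} y → i ≤ j → occ S i y ≤ occ S j y
  occ-mono {j = zero}  y z≤n = ≤-refl
  occ-mono {j = suc j} y i≤j with m≤n⇒m<n∨m≡n i≤j
  ... | inj₁ i<1+j = ≤-trans (occ-mono y (s≤s⁻¹ i<1+j)) (m≤m+n _ _)
  ... | inj₂ refl  = ≤-refl

  occ-strict : ∀ {i j} y → i < j → S i ≡ y → occ S i y < occ S j y
  occ-strict {i} {j} y i<j Si≡y = subst (_≤ occ S j y) (occ-step i y Si≡y) (occ-mono y i<j)

  occ-injective : ∀ {i i'} y → S i ≡ y → S i' ≡ y → occ S i y ≡ occ S i' y → i ≡ i'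
  occ-injective {i} {i'} y Si≡y Si'≡y eq with <-cmp i i'
  ... | tri< i<i' _ _ = contradiction eq (<⇒≢ (occ-strict y i<i' Si≡y))
  ... | tri≈ _ i≡i' _ = i≡i'
  ... | tri> _ _ i'<i = contradiction (sym eq) (<⇒≢ (occ-strict y i'<i Si'≡y))

  nthOccurrence : ∀ j y t → t < occ S j y → Σ[ i ∈ ℕ ] (i < j × S i ≡ y × occ S i y ≡ t)
  nthOccurrence (suc j) y t t<occ with S j ≟ᶠ y | t <? occ S j y
  ... | _ | yes t<occ' =
    let (i , i<j , Si≡y , occ≡t) = nthOccurrence j y t t<occ'
    in i , m<n⇒m<1+n i<j , Si≡y , occ≡t
  ... | no _ | no t≮occ' = contradiction (subst (t <_) (+-identityʳ _) t<occ) t≮occ'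
  ... | yes Sj≡y | no t≮occ' =
    j , ≤-refl , Sj≡y , ≤-antisym (≮⇒≥ t≮occ') (s≤s⁻¹ (subst (t <_) (+-comm _ 1) t<occ))

  occIndex : ∀ {j y} (i : Fin j) → S (toℕ i) ≡ y → Fin (occ S j y)
  occIndex {y = y} i Si≡y = fromℕ< (occ-strict y (toℕ<n i) Si≡y)

  occIndex-injective : ∀ {j y} {i i' : Fin j} (e : S (toℕ i) ≡ y) (e' : S (toℕ i') ≡ y) →
                       occIndex i e ≡ occIndex i' e' → i ≡ i'
  occIndex-injective {y = y} {i} {i'} e e' eq = toℕ-injective (occ-injective y e e' (begin
    occ S (toℕ i) y      ≡⟨ sym (toℕ-fromℕ< _) ⟩
    toℕ (occIndex i e)   ≡⟨ cong toℕ eq ⟩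
    toℕ (occIndex i' e') ≡⟨ toℕ-fromℕ< _ ⟩
    occ S (toℕ i') y     ∎))
    where open ≡-Reasoning

-- Where R holds both ways, the smaller endpoint points to the
-- larger one.
module OrientAlong {r} (H : SimpleGraph r) {R : Fin r → Fin r → Set}
                   (R? : ∀ a b → Dec (R a b))
                   (R⇒edge : ∀ {a b} → R a b → adj H a b ≡ true)
                   (edge⇒R : ∀ {a b} → adj H a b ≡ true → R a b ⊎ R b a) where

  tiebreak : Bool → Bool → Bool → Bool
  tiebreak false _     _   = false
  tiebreak true  false _   = true
  tiebreak true  true  a<b = a<b

  arcR : Fin r → Fin r → Bool
  arcR a b = tiebreak (does (R? a b)) (does (R? b a)) (does (a Fin.<? b))

  arcR⇒R : ∀ a b → arcR a b ≡ true → R a b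
  arcR⇒R a b e with R? a b
  ... | yes Rab = Rab
  ... | no _    = contradiction e λ ()

  R-irreflexive : ∀ a → ¬ R a a
  R-irreflexive a Raa = contradiction (trans (sym (R⇒edge Raa)) (irrefl H a)) λ ()

  edge⇒arcR : ∀ a b → adj H a b ≡ true → arcR a b ≡ true ⊎ arcR b a ≡ true
  edge⇒arcR a b ab with R? a b | R? b a
  ... | yes _   | no _    = inj₁ refl
  ... | no _    | yes _   = inj₂ refl
  ... | no ¬Rab | no ¬Rba = ⊥-elim ([ ¬Rab , ¬Rba ] (edge⇒R ab))
  ... | yes Rab | yes _ with Fin.<-cmp a b
  ...   | tri< a<b _ _  = inj₁ (dec-true (a Fin.<? b) a<b)
  ...   | tri≈ _ refl _ = ⊥-elim (R-irreflexive a Rab)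
  ...   | tri> _ _ b<a  = inj₂ (dec-true (b Fin.<? a) b<a)

  arcR-antisym : ∀ a b → arcR a b ≡ true → arcR b a ≡ false
  arcR-antisym a b e with R? a b | R? b a
  ... | no _  | _     = contradiction e λ ()
  ... | yes _ | no _  = refl
  ... | yes _ | yes _ with b Fin.<? a
  ...   | no b≮a  = dec-false (b Fin.<? a) b≮a
  ...   | yes b<a = contradiction (trans (sym e) (dec-false (a Fin.<? b) (Fin.<-asym b<a))) λ ()

  orientation : Orientation H
  orientation = record
    { arc      = arcR
    ; arc⇒edge = λ a b e → R⇒edge (arcR⇒R a b e)
    ; edge⇒arc = edge⇒arcR
    ; antisym  = arcR-antisym
    }

module Strategy {n r} {H : SimpleGraph r} (S : ℕ → Fin n) (D : Orientation H)
                (x : Fin r → Fin n) (x-injective : Injective _≡_ _≡_ x) where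

  open Occurrences S

  -- Round i: if the offered vertex is x a and it has been offered t < d⁺(a)
  -- times before, join it to x b for the out-neighbour b of a of rank t.
  -- Otherwise the move is irrelevant.
  move : ℕ → Fin n
  move i with any? (λ a → x a ≟ᶠ S i)
  ... | no _        = S i
  ... | yes (a , _) with occ S i (S i) <? outdeg D a
  ...   | yes t<d = x (proj₁ (select (arc D a) _ t<d))
  ...   | no _    = S i

  move-realises : ∀ i a b → S i ≡ x a → arc D a b ≡ true →
                  occ S i (S i) ≡ rank (arc D a) b → move i ≡ x b
  move-realises i a b Si≡xa ab t≡rank with any? (λ a → x a ≟ᶠ S i)
  ... | no none = ⊥-elim (none (a , sym Si≡xa))
  ... | yes (a' , xa'≡Si) with x-injective (trans xa'≡Si Si≡xa)
  ...   | refl with occ S i (S i) <? outdeg D a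
  ...     | no t≮d  =
    contradiction (subst (_< outdeg D a) (sym t≡rank) (rank<countFin (arc D a) b ab)) t≮d
  ...     | yes t<d =
    let (c , ac , rank-c) = select (arc D a) _ t<d
    in cong x (rank-injective (arc D a) ac ab (trans rank-c t≡rank))

  -- If every x a is offered at least d⁺(a) times in the first j rounds, then
  -- each arc a → b is realised in one of them: the (rank of b)-th offer of x a.
  arc-realised : ∀ j → (∀ a → outdeg D a ≤ occ S j (x a)) → ∀ a b → arc D a b ≡ true →
                 Σ[ i ∈ Fin j ] (move (toℕ i) ≡ x b × S (toℕ i) ≡ x a)
  arc-realised j enough a b ab =
    let (i , i<j , Si≡xa , occ≡rank) = nthOccurrence j (x a) (rank (arc D a) b)
                                         (≤-trans (rank<countFin (arc D a) b ab) (enough a))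
        joins  = move-realises i a b Si≡xa ab (trans (cong (occ S i) Si≡xa) occ≡rank)
        i≡toℕi = sym (toℕ-fromℕ< i<j)
    in fromℕ< i<j
     , subst (λ k → move k ≡ x b) i≡toℕi joins
     , subst (λ k → S k ≡ x a) i≡toℕi Si≡xa

orientable⇒builderCan : ∀ {n r} (H : SimpleGraph r) (S : ℕ → Fin n) j →
                        Σ[ D ∈ Orientation H ] CondD S D j → BuilderCan H S j
orientable⇒builderCan H S j (D , x , x-injective , enough) =
  (move ∘ toℕ) , x , x-injective , edge-realised
  where
  open Strategy S D x x-injective
  edge-realised : ∀ a b → adj H a b ≡ true →
    Σ[ i ∈ Fin j ] ((move (toℕ i) ≡ x a × S (toℕ i) ≡ x b) ⊎
                    (move (toℕ i) ≡ x b × S (toℕ i) ≡ x a))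
  edge-realised a b ab with edge⇒arc D a b ab
  ... | inj₁ a→b = let (i , realised) = arc-realised j enough a b a→b in i , inj₂ realised
  ... | inj₂ b→a = let (i , realised) = arc-realised j enough b a b→a in i , inj₁ realised

module RealisedCopy {n r} (H : SimpleGraph r) (S : ℕ → Fin n) {j} (u : Fin j → Fin n)
  (f : Fin r → Fin n) (f-injective : Injective _≡_ _≡_ f)
  (realised : ∀ a b → adj H a b ≡ true →
     Σ[ i ∈ Fin j ] ((u i ≡ f a × S (toℕ i) ≡ f b) ⊎ (u i ≡ f b × S (toℕ i) ≡ f a))) where

  open Occurrences S

  OfferedTo : Fin r → Fin r → Set
  OfferedTo a b = Σ[ i ∈ Fin j ] (S (toℕ i) ≡ f a × u i ≡ f b)

  Realised→ : Fin r → Fin r → Set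
  Realised→ a b = adj H a b ≡ true × OfferedTo a b

  Realised→? : ∀ a b → Dec (Realised→ a b)
  Realised→? a b =
    (adj H a b Bool.≟ true) ×-dec any? (λ i → (S (toℕ i) ≟ᶠ f a) ×-dec (u i ≟ᶠ f b))

  edge⇒realised : ∀ {a b} → adj H a b ≡ true → Realised→ a b ⊎ Realised→ b a
  edge⇒realised {a} {b} ab with realised a b ab
  ... | i , inj₁ (ui≡fa , Si≡fb) = inj₂ (trans (SimpleGraph.sym H b a) ab , i , Si≡fb , ui≡fa)
  ... | i , inj₂ (ui≡fb , Si≡fa) = inj₁ (ab , i , Si≡fa , ui≡fb)

  open OrientAlong H Realised→? proj₁ edge⇒realised public using (orientation; arcR; arcR⇒R)

  -- Out-neighbours b of a are realised in rounds offering f a, and distinct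
  -- out-neighbours in distinct rounds (Builder's endpoint f b determines b);
  -- numbering these rounds by occIndex bounds the out-degree.
  outdeg-bound : ∀ a → outdeg orientation a ≤ occ S j (f a)
  outdeg-bound a = countFin-≤ (arcR a) index index-injective
    where
    round : ∀ b → arcR a b ≡ true → OfferedTo a b
    round b ab = proj₂ (arcR⇒R a b ab)

    index : ∀ b → arcR a b ≡ true → Fin (occ S j (f a))
    index b ab = let (i , Si≡fa , _) = round b ab in occIndex i Si≡fa

    index-injective : ∀ {b c} ab ac → index b ab ≡ index c ac → b ≡ c
    index-injective {b} {c} ab ac eq =
      let (i  , Si≡fa  , ui≡fb)  = round b ab
          (i' , Si'≡fa , ui'≡fc) = round c ac
      in f-injective (trans (sym ui≡fb)
                     (trans (cong u (occIndex-injective Si≡fa Si'≡fa eq)) ui'≡fc))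

builderCan⇒orientable : ∀ {n r} (H : SimpleGraph r) (S : ℕ → Fin n) j →
                        BuilderCan H S j → Σ[ D ∈ Orientation H ] CondD S D j
builderCan⇒orientable H S j (u , f , f-injective , realised) =
  orientation , f , f-injective , outdeg-bound
  where open RealisedCopy H S u f f-injective realised

builderCan⇔orientable : ∀ {n r} (H : SimpleGraph r) (S : ℕ → Fin n) j →
                        BuilderCan H S j ⇔ (Σ[ D ∈ Orientation H ] CondD S D j)
builderCan⇔orientable H S j =
  mk⇔ (builderCan⇒orientable H S j) (orientable⇒builderCan H S j)

-- A satisfiable predicate on ℕ cannot fail to have a least witness
-- (constructively we only get the double negation; it suffices for refutations).
¬¬least : (P : ℕ → Set) → ∀ j → P j → ¬ ¬ (Σ[ k ∈ ℕ ] IsLeast P k)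
¬¬least P = <-rec (λ j → P j → ¬ ¬ (Σ[ k ∈ ℕ ] IsLeast P k))
  λ j smaller Pj noLeast → noLeast (j , Pj , λ i i<j Pi → smaller i<j Pi noLeast)

IsMinOfLeasts : {I : Set} → (I → ℕ → Set) → ℕ → Set
IsMinOfLeasts {I} Q k = Σ[ d ∈ I ] (IsLeast (Q d) k × (∀ d' k' → IsLeast (Q d') k' → k ≤ k'))

least-of-union : {I : Set} (P : ℕ → Set) (Q : I → ℕ → Set) →
                 (∀ j → P j ⇔ (Σ[ d ∈ I ] Q d j)) → ∀ k → IsLeast P k ⇔ IsMinOfLeasts Q k
least-of-union {I} P Q P⇔Q k = mk⇔ least⇒ ⇒least
  where
  memberOf : ∀ {j} → P j → Σ[ d ∈ I ] Q d j
  memberOf = Equivalence.to (P⇔Q _)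

  inUnion : ∀ {j} d → Q d j → P j
  inUnion d Qdj = Equivalence.from (P⇔Q _) (d , Qdj)

  least⇒ : IsLeast P k → IsMinOfLeasts Q k
  least⇒ (Pk , noneBelow) =
    let (d , Qdk) = memberOf Pk
    in d , (Qdk , λ j j<k Qdj → noneBelow j j<k (inUnion d Qdj))
         , λ d' k' (Qd'k' , _) → ≮⇒≥ λ k'<k → noneBelow k' k'<k (inUnion d' Qd'k')

  -- A witness j < k of P lies in some Q d', whose least element k' would
  -- satisfy k ≤ k' ≤ j < k.
  ⇒least : IsMinOfLeasts Q k → IsLeast P k
  ⇒least (d , (Qdk , _) , minimal) = inUnion d Qdk , λ j j<k Pj →
    let (d' , Qd'j) = memberOf Pj
    in ¬¬least (Q d') j Qd'j λ (k' , leastk') →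
         let k≤k' = minimal d' k' leastk'
             k'≤j = ≮⇒≥ λ j<k' → proj₂ leastk' j j<k' Qd'j
         in <-irrefl refl (<-≤-trans j<k (≤-trans k≤k' k'≤j))

-- Proposition 4.1: the least number of rounds after which Builder can own a
-- copy of H is m(H).
proposition4p1 : ∀ {n r} → r ≤ n → (H : SimpleGraph r) → (S : ℕ → Fin n) →
    ∀ k → IsLeast (BuilderCan H S) k ⇔ mH≡ H S k
proposition4p1 _ H S =
  least-of-union (BuilderCan H S) (λ D → CondD S D) (builderCan⇔orientable H S)
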